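{- Let $G=(V,E,w)$ be a graph on $n$ vertices with nonnegative weights $w_{ij}$. The algorithm \texttt{Recursive-Random-Cutting} outputs a hierarchical clustering $T$ whose expected objective $\mathbb{E}\big[\sum_{(i,j)\in E}w_{ij}|T_{ij}|\big]$ is at least $\frac23\max_{T'}\sum_{(i,j)\in E}w_{ij}|T'_{ij}|$, the maximum over all hierarchical clusterings $T'$ on $V$.
   Context: A hierarchical clustering on $V$ is a rooted binary tree with leaf set $V$; $T_{ij}$ is the subtree rooted at the lowest common ancestor of $i,j$, and $|T_{ij}|$ its number of leaves (the dissimilarity-HC objective is to maximize $\sum w_{ij}|T_{ij}|$). \texttt{Recursive-Random-Cutting}: a cluster $A$ with $|A|\ge2$ is split by having each point of $A$ independently flip a fair coin and placing it in the left or right part accordingly (if one part is empty, the coin flips are repeated); the algorithm recurses on both parts until all clusters are singletons, and the parts become the children of $A$ in the tree.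
   Formalization: The weights $w_{ij}$ are nonnegative rationals. -}

module Defs where

open import Data.Bool using (Bool; true; false; if_then_else_; _∧_; _∨_)
open import Data.Nat as ℕ using (ℕ; zero; suc)
open import Data.Fin using (Fin; toℕ)
open import Data.Fin.Properties using (_≟_)
open import Data.Integer using (+_)
open import Data.List using (List; []; _∷_; [_]; _++_; map; concatMap; length; foldr; allFin)
open import Data.List.Relation.Binary.Permutation.Propositional using (_↭_)
open import Data.Product using (_×_; _,_)
open import Data.Rational using (ℚ; _/_; _+_; _*_; 0ℚ; 1ℚ)
open import Relation.Nullary using (does)

data Tree (n : ℕ) : Set where
  leaf : Fin n → Tree n
  node : Tree n → Tree n → Tree n

leaves : ∀ {n} → Tree n → List (Fin n)
leaves (leaf i) = [ i ]
leaves (node l r) = leaves l ++ leaves r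

IsHC : ∀ {n} → Tree n → Set
IsHC {n} T = leaves T ↭ allFin n

memb : ∀ {n} → Fin n → List (Fin n) → Bool
memb i [] = false
memb i (k ∷ ks) = does (i ≟ k) ∨ memb i ks

-- |T_ij| : number of leaves of the subtree rooted at the lowest common ancestor of i and j.
lcaSize : ∀ {n} → Tree n → Fin n → Fin n → ℕ
lcaSize (leaf _) i j = 1
lcaSize (node l r) i j =
  if memb i (leaves l) ∧ memb j (leaves l) then lcaSize l i j
  else if memb i (leaves r) ∧ memb j (leaves r) then lcaSize r i j
  else length (leaves (node l r))

ℕtoℚ : ℕ → ℚ
ℕtoℚ k = + k / 1

sumℚ : List ℚ → ℚ
sumℚ = foldr _+_ 0ℚ

-- unordered pairs {i,j}, i ≠ j, represented as (i , j) with i < j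
pairs : ∀ n → List (Fin n × Fin n)
pairs n = concatMap (λ i → concatMap (λ j → if does (toℕ i ℕ.<? toℕ j) then [ (i , j) ] else []) (allFin n)) (allFin n)

objective : ∀ {n} → (Fin n → Fin n → ℚ) → Tree n → ℚ
objective {n} w T = sumℚ (map (λ { (i , j) → w i j * ℕtoℚ (lcaSize T i j) }) (pairs n))

Dist : Set → Set
Dist A = List (ℚ × A)

expect : ∀ {A : Set} → Dist A → (A → ℚ) → ℚ
expect d f = sumℚ (map (λ { (p , a) → p * f a }) d)

-- All 2^|A| ways of assigning each point of A (by a coin flip) to the left or right part.
splits : ∀ {n} → List (Fin n) → List (List (Fin n) × List (Fin n))
splits [] = [ ([] , []) ]
splits (x ∷ xs) = concatMap (λ { (L , R) → (x ∷ L , R) ∷ (L , x ∷ R) ∷ [] }) (splits xs)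

-- Those with both parts nonempty (rejection of outcomes with an empty part).
properSplits : ∀ {n} → List (Fin n) → List (List (Fin n) × List (Fin n))
properSplits A = concatMap keep (splits A)
  where
  keep : _ → List _
  keep ([] , _) = []
  keep (_ , []) = []
  keep (L , R) = [ (L , R) ]

uniformWeight : ℕ → ℚ
uniformWeight zero = 0ℚ
uniformWeight (suc m) = + 1 / suc m

-- Output distribution of Recursive-Random-Cutting on cluster A, with fuel
-- (fuel ≥ |A| suffices, since each part is strictly smaller than A).
rrc : ∀ {n} → ℕ → List (Fin n) → Dist (Tree n)
rrc _ [] = []
rrc _ (x ∷ []) = [ (1ℚ , leaf x) ]
rrc zero (x ∷ y ∷ zs) = []
rrc (suc f) (x ∷ y ∷ zs) =
  concatMap
    (λ { (L , R) →
       concatMap (λ { (pl , tl) →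
         map (λ { (pr , tr) → (p * pl * pr , node tl tr) }) (rrc f R) }) (rrc f L) })
    S
  where
  S = properSplits (x ∷ y ∷ zs)
  p = uniformWeight (length S)

recursiveRandomCutting : ∀ n → Dist (Tree n)
recursiveRandomCutting n = rrc n (allFin n)

module Submission where

-- Fix i ≠ j.  By induction on a cluster A containing i and j, Recursive-Random-Cutting
-- run on A gives E|T_ij| ≥ (2|A| + 2)/3: if the first cut (L , R) keeps i and j in a
-- part of size k, induction gives (2k + 2)/3, and otherwise |T_ij| = |A|.  Summed over the
-- four placements of i and j alone, three times these bounds add up to exactly
-- 4 (2|A| + 2), so their average over all 2^|A| cuts is 2|A| + 2; the two rejected
-- cuts (A , []) and ([] , A) carry exactly that value too, so the average over proper cuts
-- is the same.  Hence E|T_ij| ≥ (2n + 2)/3 ≥ (2/3) n ≥ (2/3) |T′_ij| for every hierarchical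
-- clustering T′, and the theorem follows by linearity of expectation, as w ≥ 0.

open import Defs
open import Data.Nat using (ℕ)
open import Data.Fin using (Fin)
open import Data.Integer using (+_)
open import Data.Rational using (ℚ; _≤_; _*_; _/_; 0ℚ)

open import Algebra.Bundles using (CommutativeMonoid)
import Algebra.Properties.CommutativeSemigroup as CommSemigroup
open import Data.Bool using (true; false; T; if_then_else_; _∧_; _∨_)
open import Data.Bool.Properties using (∧-conicalˡ; ∧-conicalʳ)
open import Data.Fin using (toℕ)
import Data.Fin.Properties as Fin
import Data.Integer as ℤ
import Data.Integer.Properties as ℤ
open import Data.List using (List; []; _∷_; [_]; _++_; map; concatMap; length; allFin)
import Data.List.Properties as List
open import Data.List.Membership.Propositional using (_∈_; _∉_)
open import Data.List.Membership.Propositional.Properties using (∈-∃++; ∈-++⁺ˡ; ∈-++⁺ʳ; ∈-allFin)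
open import Data.List.Relation.Binary.Permutation.Propositional as ↭ using (_↭_; ↭-sym; ↭-trans; ↭⇒↭ₛ)
open import Data.List.Relation.Binary.Permutation.Propositional.Properties
  using (shift; ↭-length; ∈-resp-↭; ¬x∷xs↭[]) renaming (++⁺ to ++⁺-↭)
import Data.List.Relation.Binary.Permutation.Setoid.Properties as PermutationSetoid
open import Data.List.Relation.Unary.All as All using (All; []; _∷_)
import Data.List.Relation.Unary.All.Properties as All
open import Data.List.Relation.Unary.AllPairs using ([]; _∷_)
open import Data.List.Relation.Unary.Any using (here; there; any?)
open import Data.List.Relation.Unary.Unique.Propositional using (Unique)
open import Data.List.Relation.Unary.Unique.Propositional.Properties using (allFin⁺; Unique[x∷xs]⇒x∉xs)
import Data.Nat as ℕ
import Data.Nat.Coprimality as Coprime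
open import Data.Nat.ListAction using (sum)
import Data.Nat.ListAction.Properties as ℕ
import Data.Nat.Properties as ℕ
open import Data.Nat.Solver using (module +-*-Solver)
open import Data.Product using (_×_; _,_; proj₁; proj₂; ∃-syntax)
open import Data.Rational using (_+_; 1ℚ; mkℚ; toℚᵘ; nonNegative; *≤*)
import Data.Rational.Properties as ℚ
import Data.Rational.Unnormalised as ℚᵘ
import Data.Rational.Unnormalised.Properties as ℚᵘ
open import Function using (_∘_; mk⇔)
open import Relation.Binary.PropositionalEquality hiding ([_])
open import Relation.Nullary using (does; yes; no; contradiction)
open import Relation.Nullary.Decidable using (dec-true; dec-false; does-⇔)

module ℕ+ = CommSemigroup ℕ.+-commutativeSemigroup
module ℚ+ = CommSemigroup (CommutativeMonoid.commutativeSemigroup ℚ.+-0-commutativeMonoid)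
module ℚ* = CommSemigroup (CommutativeMonoid.commutativeSemigroup ℚ.*-1-commutativeMonoid)

ℕtoℚ≡mkℚ : ∀ k → ℕtoℚ k ≡ mkℚ (+ k) 0 (Coprime.sym (Coprime.1-coprimeTo k))
ℕtoℚ≡mkℚ k = ℚ.normalize-coprime (Coprime.sym (Coprime.1-coprimeTo k))

ℕtoℚ-+ : ∀ a b → ℕtoℚ (a ℕ.+ b) ≡ ℕtoℚ a + ℕtoℚ b
ℕtoℚ-+ a b = ℚ.toℚᵘ-injective (ℚᵘ.≃-trans toℚᵘ-+ (ℚᵘ.≃-sym (ℚ.toℚᵘ-homo-+ (ℕtoℚ a) (ℕtoℚ b))))
  where
  toℚᵘ-+ : toℚᵘ (ℕtoℚ (a ℕ.+ b)) ℚᵘ.≃ toℚᵘ (ℕtoℚ a) ℚᵘ.+ toℚᵘ (ℕtoℚ b)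
  toℚᵘ-+ rewrite ℕtoℚ≡mkℚ (a ℕ.+ b) | ℕtoℚ≡mkℚ a | ℕtoℚ≡mkℚ b =
    ℚᵘ.*≡* (cong (ℤ._* + 1) (trans (ℤ.pos-+ a b) (sym (cong₂ ℤ._+_ (ℤ.*-identityʳ (+ a)) (ℤ.*-identityʳ (+ b))))))

ℕtoℚ-* : ∀ a b → ℕtoℚ (a ℕ.* b) ≡ ℕtoℚ a * ℕtoℚ b
ℕtoℚ-* a b = ℚ.toℚᵘ-injective (ℚᵘ.≃-trans toℚᵘ-* (ℚᵘ.≃-sym (ℚ.toℚᵘ-homo-* (ℕtoℚ a) (ℕtoℚ b))))
  where
  toℚᵘ-* : toℚᵘ (ℕtoℚ (a ℕ.* b)) ℚᵘ.≃ toℚᵘ (ℕtoℚ a) ℚᵘ.* toℚᵘ (ℕtoℚ b)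
  toℚᵘ-* rewrite ℕtoℚ≡mkℚ (a ℕ.* b) | ℕtoℚ≡mkℚ a | ℕtoℚ≡mkℚ b =
    ℚᵘ.*≡* (cong (ℤ._* + 1) (ℤ.pos-* a b))

ℕtoℚ-mono-≤ : ∀ {a b} → a ℕ.≤ b → ℕtoℚ a ≤ ℕtoℚ b
ℕtoℚ-mono-≤ {a} {b} a≤b rewrite ℕtoℚ≡mkℚ a | ℕtoℚ≡mkℚ b =
  *≤* (subst₂ ℤ._≤_ (sym (ℤ.*-identityʳ (+ a))) (sym (ℤ.*-identityʳ (+ b))) (ℤ.+≤+ a≤b))

uniformWeight-inverse : ∀ m .{{_ : ℕ.NonZero m}} → uniformWeight m * ℕtoℚ m ≡ 1ℚ
uniformWeight-inverse (ℕ.suc m)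
  rewrite ℕtoℚ≡mkℚ (ℕ.suc m) | ℚ.normalize-coprime {1} {m} (Coprime.1-coprimeTo (ℕ.suc m)) =
  ℚ.*-inverseˡ (mkℚ (+ ℕ.suc m) 0 (Coprime.sym (Coprime.1-coprimeTo (ℕ.suc m))))

uniformWeight-nonNeg : ∀ m → 0ℚ ≤ uniformWeight m
uniformWeight-nonNeg ℕ.zero = ℚ.≤-refl
uniformWeight-nonNeg (ℕ.suc m) rewrite ℚ.normalize-coprime {1} {m} (Coprime.1-coprimeTo (ℕ.suc m)) = ℚ.nonNegative⁻¹ _

nonNeg*nonNeg : ∀ {a b} → 0ℚ ≤ a → 0ℚ ≤ b → 0ℚ ≤ a * b
nonNeg*nonNeg {a} {b} 0≤a 0≤b =
  ℚ.nonNegative⁻¹ (a * b) {{ℚ.nonNeg*nonNeg⇒nonNeg a {{nonNegative 0≤a}} b {{nonNegative 0≤b}}}}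

All-concatMap⁺ : ∀ {A B : Set} {P : B → Set} (g : A → List B) xs → All (λ x → All P (g x)) xs → All P (concatMap g xs)
All-concatMap⁺ g xs = All.concat⁺ ∘ All.map⁺

module _ {A : Set} where

  sumℚ-++ : ∀ (f : A → ℚ) xs ys → sumℚ (map f (xs ++ ys)) ≡ sumℚ (map f xs) + sumℚ (map f ys)
  sumℚ-++ f [] ys = sym (ℚ.+-identityˡ _)
  sumℚ-++ f (x ∷ xs) ys = trans (cong (λ s → f x + s) (sumℚ-++ f xs ys)) (sym (ℚ.+-assoc (f x) _ _))

  sumℚ-cong : ∀ {f g : A → ℚ} {xs} → All (λ x → f x ≡ g x) xs → sumℚ (map f xs) ≡ sumℚ (map g xs)
  sumℚ-cong fs≡gs = cong sumℚ (List.map-cong-local fs≡gs)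

  sumℚ-mono-≤ : ∀ {f g : A → ℚ} {xs} → All (λ x → f x ≤ g x) xs → sumℚ (map f xs) ≤ sumℚ (map g xs)
  sumℚ-mono-≤ [] = ℚ.≤-refl
  sumℚ-mono-≤ (fx≤gx ∷ fs≤gs) = ℚ.+-mono-≤ fx≤gx (sumℚ-mono-≤ fs≤gs)

  sumℚ-*ˡ : ∀ c (f : A → ℚ) xs → c * sumℚ (map f xs) ≡ sumℚ (map (λ x → c * f x) xs)
  sumℚ-*ˡ c f [] = ℚ.*-zeroʳ c
  sumℚ-*ˡ c f (x ∷ xs) = trans (ℚ.*-distribˡ-+ c (f x) _) (cong (λ s → c * f x + s) (sumℚ-*ˡ c f xs))

  sumℚ-+ : ∀ (f g : A → ℚ) xs → sumℚ (map (λ x → f x + g x) xs) ≡ sumℚ (map f xs) + sumℚ (map g xs)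
  sumℚ-+ f g [] = refl
  sumℚ-+ f g (x ∷ xs) =
    trans (cong (λ s → f x + g x + s) (sumℚ-+ f g xs)) (ℚ+.interchange (f x) (g x) _ _)

  sumℚ-const : ∀ c (xs : List A) → sumℚ (map (λ _ → c) xs) ≡ ℕtoℚ (length xs) * c
  sumℚ-const c [] = sym (ℚ.*-zeroˡ c)
  sumℚ-const c (x ∷ xs) = begin
    c + sumℚ (map (λ _ → c) xs)       ≡⟨ cong (λ s → c + s) (sumℚ-const c xs) ⟩
    c + ℕtoℚ (length xs) * c          ≡⟨ cong (λ t → t + ℕtoℚ (length xs) * c) (sym (ℚ.*-identityˡ c)) ⟩
    1ℚ * c + ℕtoℚ (length xs) * c     ≡⟨ sym (ℚ.*-distribʳ-+ c 1ℚ (ℕtoℚ (length xs))) ⟩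
    (1ℚ + ℕtoℚ (length xs)) * c       ≡⟨ cong (_* c) (sym (ℕtoℚ-+ 1 (length xs))) ⟩
    ℕtoℚ (length (x ∷ xs)) * c        ∎
    where open ≡-Reasoning

sumℚ-concatMap : ∀ {A B : Set} (f : B → ℚ) (g : A → List B) xs →
  sumℚ (map f (concatMap g xs)) ≡ sumℚ (map (λ x → sumℚ (map f (g x))) xs)
sumℚ-concatMap f g [] = refl
sumℚ-concatMap f g (x ∷ xs) =
  trans (sumℚ-++ f (g x) (concatMap g xs)) (cong (λ s → sumℚ (map f (g x)) + s) (sumℚ-concatMap f g xs))

module _ {A : Set} where

  mass : Dist A → ℚ
  mass d = expect d (λ _ → 1ℚ)

  expect-cong : ∀ {d : Dist A} {f g} → All (λ (_ , a) → f a ≡ g a) d → expect d f ≡ expect d g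
  expect-cong fs≡gs = sumℚ-cong (All.map (λ {(p , _)} → cong (p *_)) fs≡gs)

  expect-*ˡ : ∀ (d : Dist A) c f → expect d (λ a → c * f a) ≡ c * expect d f
  expect-*ˡ d c f = trans (cong sumℚ (List.map-cong (λ (p , a) → ℚ*.x∙yz≈y∙xz p c (f a)) d)) (sym (sumℚ-*ˡ c _ d))

  expect-const : ∀ (d : Dist A) c → mass d ≡ 1ℚ → expect d (λ _ → c) ≡ c
  expect-const d c mass≡1 = begin
    expect d (λ _ → c)
      ≡⟨ cong sumℚ (List.map-cong (λ (p , _) → cong (p *_) (sym (ℚ.*-identityʳ c))) d) ⟩
    expect d (λ _ → c * 1ℚ)
      ≡⟨ expect-*ˡ d c (λ _ → 1ℚ) ⟩
    c * mass d
      ≡⟨ cong (c *_) mass≡1 ⟩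
    c * 1ℚ
      ≡⟨ ℚ.*-identityʳ c ⟩
    c ∎
    where open ≡-Reasoning

  expect-sumℚ : ∀ {X : Set} (d : Dist A) (φ : X → A → ℚ) xs →
    expect d (λ a → sumℚ (map (λ x → φ x a) xs)) ≡ sumℚ (map (λ x → expect d (φ x)) xs)
  expect-sumℚ [] φ xs = sym (trans (sumℚ-const 0ℚ xs) (ℚ.*-zeroʳ (ℕtoℚ (length xs))))
  expect-sumℚ ((p , a) ∷ d) φ xs =
    trans (cong₂ _+_ (sumℚ-*ˡ p (λ x → φ x a) xs) (expect-sumℚ d φ xs))
          (sym (sumℚ-+ (λ x → p * φ x a) (λ x → expect d (φ x)) xs))

expect-concatMap : ∀ {A B : Set} (g : A → Dist B) xs f →
  expect (concatMap g xs) f ≡ sumℚ (map (λ x → expect (g x) f) xs)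
expect-concatMap g xs f = sumℚ-concatMap (λ (p , b) → p * f b) g xs

expect-map-scale : ∀ {A B : Set} c (t : A → B) (d : Dist A) f →
  expect (map (λ (q , a) → (c * q , t a)) d) f ≡ c * expect d (λ a → f (t a))
expect-map-scale c t d f = begin
  expect (map (λ (q , a) → (c * q , t a)) d) f
    ≡⟨ cong sumℚ (sym (List.map-∘ d)) ⟩
  sumℚ (map (λ (q , a) → c * q * f (t a)) d)
    ≡⟨ cong sumℚ (List.map-cong (λ (q , a) → ℚ.*-assoc c q (f (t a))) d) ⟩
  sumℚ (map (λ (q , a) → c * (q * f (t a))) d)
    ≡⟨ sym (sumℚ-*ˡ c _ d) ⟩
  c * expect d (λ a → f (t a)) ∎
  where open ≡-Reasoning

sum-map-concatMap : ∀ {A B : Set} (F : B → ℕ) (g : A → List B) xs →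
  sum (map F (concatMap g xs)) ≡ sum (map (λ x → sum (map F (g x))) xs)
sum-map-concatMap F g [] = refl
sum-map-concatMap F g (x ∷ xs) =
  trans (cong sum (List.map-++ F (g x) (concatMap g xs)))
  (trans (ℕ.sum-++ (map F (g x)) _) (cong (sum (map F (g x)) ℕ.+_) (sum-map-concatMap F g xs)))

sum-map-+ : ∀ {A : Set} (F G : A → ℕ) xs → sum (map (λ x → F x ℕ.+ G x) xs) ≡ sum (map F xs) ℕ.+ sum (map G xs)
sum-map-+ F G [] = refl
sum-map-+ F G (x ∷ xs) =
  trans (cong (F x ℕ.+ G x ℕ.+_) (sum-map-+ F G xs)) (ℕ+.interchange (F x) (G x) _ _)

sum-map-const : ∀ {A : Set} c (xs : List A) → sum (map (λ _ → c) xs) ≡ length xs ℕ.* c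
sum-map-const c [] = refl
sum-map-const c (x ∷ xs) = cong (c ℕ.+_) (sum-map-const c xs)

ℕtoℚ-sum : ∀ {A : Set} (F : A → ℕ) xs → ℕtoℚ (sum (map F xs)) ≡ sumℚ (map (λ x → ℕtoℚ (F x)) xs)
ℕtoℚ-sum F [] = refl
ℕtoℚ-sum F (x ∷ xs) = trans (ℕtoℚ-+ (F x) _) (cong (λ s → ℕtoℚ (F x) + s) (ℕtoℚ-sum F xs))

module _ {n : ℕ} where

  memb≡any? : ∀ (k : Fin n) xs → memb k xs ≡ does (any? (k Fin.≟_) xs)
  memb≡any? k [] = refl
  memb≡any? k (x ∷ xs) = cong (does (k Fin.≟ x) ∨_) (memb≡any? k xs)

  ∈⇒memb : ∀ {k : Fin n} {xs} → k ∈ xs → memb k xs ≡ true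
  ∈⇒memb {k} {xs} k∈xs = trans (memb≡any? k xs) (dec-true (any? (k Fin.≟_) xs) k∈xs)

  ∉⇒memb : ∀ {k : Fin n} {xs} → k ∉ xs → memb k xs ≡ false
  ∉⇒memb {k} {xs} k∉xs = trans (memb≡any? k xs) (dec-false (any? (k Fin.≟_) xs) k∉xs)

  memb⇒∈ : ∀ {k : Fin n} {xs} → memb k xs ≡ true → k ∈ xs
  memb⇒∈ {k} {x ∷ xs} e with k Fin.≟ x
  ... | yes k≡x = here k≡x
  ... | no _ = there (memb⇒∈ e)

  memb-↭ : ∀ (k : Fin n) {xs ys} → xs ↭ ys → memb k xs ≡ memb k ys
  memb-↭ k {xs} {ys} xs↭ys = begin
    memb k xs
      ≡⟨ memb≡any? k xs ⟩
    does (any? (k Fin.≟_) xs)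
      ≡⟨ does-⇔ (mk⇔ (∈-resp-↭ xs↭ys) (∈-resp-↭ (↭-sym xs↭ys))) (any? (k Fin.≟_) xs) (any? (k Fin.≟_) ys) ⟩
    does (any? (k Fin.≟_) ys)
      ≡⟨ memb≡any? k ys ⟨
    memb k ys ∎
    where open ≡-Reasoning

  Unique-resp-↭ : ∀ {xs ys : List (Fin n)} → xs ↭ ys → Unique xs → Unique ys
  Unique-resp-↭ xs↭ys = PermutationSetoid.Unique-resp-↭ (setoid (Fin n)) (↭⇒↭ₛ xs↭ys)

  Unique-++⁻ˡ : ∀ (xs : List (Fin n)) {ys} → Unique (xs ++ ys) → Unique xs
  Unique-++⁻ˡ [] _ = []
  Unique-++⁻ˡ (x ∷ xs) (x∉ ∷ u) = All.++⁻ˡ xs x∉ ∷ Unique-++⁻ˡ xs u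

  Unique-++⁻ʳ : ∀ (xs : List (Fin n)) {ys} → Unique (xs ++ ys) → Unique ys
  Unique-++⁻ʳ [] u = u
  Unique-++⁻ʳ (x ∷ xs) (_ ∷ u) = Unique-++⁻ʳ xs u

  ∈⇒↭∷ : ∀ {x : Fin n} {xs} → x ∈ xs → ∃[ ys ] xs ↭ x ∷ ys
  ∈⇒↭∷ x∈xs with ys , zs , refl ← ∈-∃++ x∈xs = ys ++ zs , shift _ ys zs

  ∈×∈⇒↭∷∷ : ∀ {x y : Fin n} {xs} → x ≢ y → x ∈ xs → y ∈ xs → ∃[ ys ] xs ↭ x ∷ y ∷ ys
  ∈×∈⇒↭∷∷ x≢y x∈xs y∈xs with ys , xs↭x∷ys ← ∈⇒↭∷ x∈xs with ∈-resp-↭ xs↭x∷ys y∈xs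
  ... | here y≡x = contradiction (sym y≡x) x≢y
  ... | there y∈ys with zs , ys↭y∷zs ← ∈⇒↭∷ y∈ys = zs , ↭-trans xs↭x∷ys (↭.prep _ ys↭y∷zs)

  ∉-∷ : ∀ {x y : Fin n} {ys} → x ≢ y → x ∉ ys → x ∉ y ∷ ys
  ∉-∷ x≢y x∉ys (here x≡y) = x≢y x≡y
  ∉-∷ x≢y x∉ys (there x∈ys) = x∉ys x∈ys

-- Splits of a cluster

Split : ℕ → Set
Split n = List (Fin n) × List (Fin n)

module _ {n : ℕ} where

  IsSplitOf : List (Fin n) → Split n → Set
  IsSplitOf A (L , R) = L ++ R ↭ A

  record IsProperSplitOf (A : List (Fin n)) (S : Split n) : Set where
    constructor properSplit
    field
      isSplit : IsSplitOf A S
      left-nonEmpty : 0 ℕ.< length (proj₁ S)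
      right-nonEmpty : 0 ℕ.< length (proj₂ S)

  addLeft addRight : Fin n → Split n → Split n
  addLeft x (L , R) = (x ∷ L , R)
  addRight x (L , R) = (L , x ∷ R)

  splits-IsSplitOf : ∀ A → All (IsSplitOf A) (splits A)
  splits-IsSplitOf [] = ↭.refl ∷ []
  splits-IsSplitOf (x ∷ xs) = All-concatMap⁺ _ (splits xs) (All.map both (splits-IsSplitOf xs))
    where
    both : ∀ {S} → IsSplitOf xs S → All (IsSplitOf (x ∷ xs)) (addLeft x S ∷ addRight x S ∷ [])
    both {L , R} LR↭xs = ↭.prep x LR↭xs ∷ ↭-trans (shift x L R) (↭.prep x LR↭xs) ∷ []

  keepProper : Split n → List (Split n)
  keepProper ([] , _) = []
  keepProper (_ , []) = []
  keepProper S = [ S ]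

  -- The filter used by properSplits is local to its definition; this exposes it.
  properSplits≡ : ∀ A → properSplits A ≡ concatMap keepProper (splits A)
  properSplits≡ A =
    List.concatMap-cong (λ { ([] , R) → refl ; (x ∷ L , []) → refl ; (x ∷ L , y ∷ R) → refl }) (splits A)

  properSplits-IsProperSplitOf : ∀ A → All (IsProperSplitOf A) (properSplits A)
  properSplits-IsProperSplitOf A rewrite properSplits≡ A =
    All-concatMap⁺ keepProper (splits A) (All.map keep (splits-IsSplitOf A))
    where
    keep : ∀ {S} → IsSplitOf A S → All (IsProperSplitOf A) (keepProper S)
    keep {[] , R} _ = []
    keep {x ∷ L , []} _ = []
    keep {x ∷ L , y ∷ R} LR↭A = properSplit LR↭A ℕ.z<s ℕ.z<s ∷ []

  IsProperSplitOf⇒shorter : ∀ {A L R} → IsProperSplitOf A (L , R) → length L ℕ.< length A × length R ℕ.< length A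
  IsProperSplitOf⇒shorter {A} {L} {R} (properSplit LR↭A 0<L 0<R) =
    ℕ.<-≤-trans (ℕ.m<m+n (length L) 0<R) |LR|≤|A| , ℕ.<-≤-trans (ℕ.m<n+m (length R) 0<L) |LR|≤|A|
    where
    |LR|≤|A| : length L ℕ.+ length R ℕ.≤ length A
    |LR|≤|A| = ℕ.≤-reflexive (trans (sym (List.length-++ L)) (↭-length LR↭A))

  Σsplits : List (Fin n) → (Split n → ℕ) → ℕ
  Σsplits A F = sum (map F (splits A))

  sumPlacements : Fin n → (Split n → ℕ) → Split n → ℕ
  sumPlacements x F S = F (addLeft x S) ℕ.+ F (addRight x S)

  Σsplits-∷ : ∀ x xs F → Σsplits (x ∷ xs) F ≡ Σsplits xs (sumPlacements x F)
  Σsplits-∷ x xs F =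
    trans (sum-map-concatMap F _ (splits xs))
          (cong sum (List.map-cong (λ S → cong (F (addLeft x S) ℕ.+_) (ℕ.+-identityʳ _)) (splits xs)))

  Σsplits-∷∷ : ∀ x y xs F → Σsplits (x ∷ y ∷ xs) F ≡ Σsplits xs (sumPlacements y (sumPlacements x F))
  Σsplits-∷∷ x y xs F = trans (Σsplits-∷ x (y ∷ xs) F) (Σsplits-∷ y xs (sumPlacements x F))

  RespectsPermutation : (Split n → ℕ) → Set
  RespectsPermutation F = ∀ {L L′ R R′} → L ↭ L′ → R ↭ R′ → F (L , R) ≡ F (L′ , R′)

  sumPlacements-resp : ∀ x {F} → RespectsPermutation F → RespectsPermutation (sumPlacements x F)
  sumPlacements-resp x F-resp L↭L′ R↭R′ =
    cong₂ ℕ._+_ (F-resp (↭.prep x L↭L′) R↭R′) (F-resp L↭L′ (↭.prep x R↭R′))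

  sumPlacements-comm : ∀ x y {F} → RespectsPermutation F → ∀ S →
    sumPlacements y (sumPlacements x F) S ≡ sumPlacements x (sumPlacements y F) S
  sumPlacements-comm x y {F} F-resp (L , R)
    rewrite F-resp (↭.swap x y (↭.refl {xs = L})) (↭.refl {xs = R})
          | F-resp (↭.refl {xs = L}) (↭.swap x y (↭.refl {xs = R})) =
    ℕ+.interchange
      (F (y ∷ x ∷ L , R)) (F (y ∷ L , x ∷ R)) (F (x ∷ L , y ∷ R)) (F (L , y ∷ x ∷ R))

  Σsplits-↭ : ∀ {A B} → A ↭ B → ∀ {F} → RespectsPermutation F → Σsplits A F ≡ Σsplits B F
  Σsplits-↭ ↭.refl F-resp = refl
  Σsplits-↭ (↭.prep {xs} {ys} x p) {F} F-resp =
    trans (Σsplits-∷ x xs F) (trans (Σsplits-↭ p (sumPlacements-resp x F-resp)) (sym (Σsplits-∷ x ys F)))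
  Σsplits-↭ (↭.swap {xs} {ys} x y p) {F} F-resp = begin
    Σsplits (x ∷ y ∷ xs) F
      ≡⟨ Σsplits-∷∷ x y xs F ⟩
    Σsplits xs (sumPlacements y (sumPlacements x F))
      ≡⟨ Σsplits-↭ p (sumPlacements-resp y (sumPlacements-resp x F-resp)) ⟩
    Σsplits ys (sumPlacements y (sumPlacements x F))
      ≡⟨ cong sum (List.map-cong (sumPlacements-comm x y F-resp) (splits ys)) ⟩
    Σsplits ys (sumPlacements x (sumPlacements y F))
      ≡⟨ Σsplits-∷∷ y x ys F ⟨
    Σsplits (y ∷ x ∷ ys) F ∎
    where open ≡-Reasoning
  Σsplits-↭ (↭.trans p q) F-resp = trans (Σsplits-↭ p F-resp) (Σsplits-↭ q F-resp)

  onlyRightEmpty onlyLeftEmpty : (Split n → ℕ) → Split n → ℕ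
  onlyRightEmpty F (L , []) = F (L , [])
  onlyRightEmpty F (L , _ ∷ _) = 0
  onlyLeftEmpty F ([] , R) = F ([] , R)
  onlyLeftEmpty F (_ ∷ _ , R) = 0

  Σsplits-onlyRightEmpty : ∀ xs F → Σsplits xs (onlyRightEmpty F) ≡ F (xs , [])
  Σsplits-onlyRightEmpty [] F = ℕ.+-identityʳ _
  Σsplits-onlyRightEmpty (x ∷ xs) F =
    trans (Σsplits-∷ x xs (onlyRightEmpty F))
    (trans (cong sum (List.map-cong sumPlacements-onlyRightEmpty (splits xs)))
           (Σsplits-onlyRightEmpty xs (λ S → F (addLeft x S))))
    where
    sumPlacements-onlyRightEmpty : ∀ S →
      sumPlacements x (onlyRightEmpty F) S ≡ onlyRightEmpty (λ S → F (addLeft x S)) S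
    sumPlacements-onlyRightEmpty (L , []) = ℕ.+-identityʳ _
    sumPlacements-onlyRightEmpty (L , _ ∷ _) = refl

  Σsplits-onlyLeftEmpty : ∀ xs F → Σsplits xs (onlyLeftEmpty F) ≡ F ([] , xs)
  Σsplits-onlyLeftEmpty [] F = ℕ.+-identityʳ _
  Σsplits-onlyLeftEmpty (x ∷ xs) F =
    trans (Σsplits-∷ x xs (onlyLeftEmpty F))
    (trans (cong sum (List.map-cong sumPlacements-onlyLeftEmpty (splits xs)))
           (Σsplits-onlyLeftEmpty xs (λ S → F (addRight x S))))
    where
    sumPlacements-onlyLeftEmpty : ∀ S → sumPlacements x (onlyLeftEmpty F) S ≡ onlyLeftEmpty (λ S → F (addRight x S)) S
    sumPlacements-onlyLeftEmpty ([] , R) = refl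
    sumPlacements-onlyLeftEmpty (_ ∷ _ , R) = refl

  Σsplits-properSplits : ∀ x xs F →
    Σsplits (x ∷ xs) F ≡ sum (map F (properSplits (x ∷ xs))) ℕ.+ F (x ∷ xs , []) ℕ.+ F ([] , x ∷ xs)
  Σsplits-properSplits x xs F = begin
    Σsplits A F
      ≡⟨ cong sum (List.map-cong-local (All.map decompose (splits-IsSplitOf A))) ⟩
    sum (map (λ S → proper S ℕ.+ onlyRightEmpty F S ℕ.+ onlyLeftEmpty F S) (splits A))
      ≡⟨ trans (sum-map-+ _ (onlyLeftEmpty F) (splits A))
               (cong (ℕ._+ Σsplits A (onlyLeftEmpty F)) (sum-map-+ proper (onlyRightEmpty F) (splits A))) ⟩
    Σsplits A proper ℕ.+ Σsplits A (onlyRightEmpty F) ℕ.+ Σsplits A (onlyLeftEmpty F)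
      ≡⟨ cong₂ ℕ._+_ (cong₂ ℕ._+_ Σproper (Σsplits-onlyRightEmpty A F)) (Σsplits-onlyLeftEmpty A F) ⟩
    sum (map F (properSplits A)) ℕ.+ F (A , []) ℕ.+ F ([] , A)
      ∎
    where
    open ≡-Reasoning
    A : List (Fin n)
    A = x ∷ xs
    proper : Split n → ℕ
    proper S = sum (map F (keepProper S))
    Σproper : Σsplits A proper ≡ sum (map F (properSplits A))
    Σproper = trans (sym (sum-map-concatMap F keepProper (splits A)))
                    (cong (λ Ss → sum (map F Ss)) (sym (properSplits≡ A)))
    decompose : ∀ {S} → IsSplitOf A S → F S ≡ proper S ℕ.+ onlyRightEmpty F S ℕ.+ onlyLeftEmpty F S
    decompose {[] , []} []↭A = contradiction (↭-sym []↭A) ¬x∷xs↭[]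
    decompose {[] , _ ∷ _} _ = refl
    decompose {_ ∷ _ , []} _ = sym (ℕ.+-identityʳ _)
    decompose {_ ∷ _ , _ ∷ _} _ = sym (trans (ℕ.+-identityʳ _) (trans (ℕ.+-identityʳ _) (ℕ.+-identityʳ _)))

  Σsplits-const : ∀ xs c → Σsplits xs (λ _ → c) ≡ 2 ℕ.^ length xs ℕ.* c
  Σsplits-const [] c = refl
  Σsplits-const (x ∷ xs) c =
    trans (Σsplits-∷ x xs (λ _ → c)) (trans (Σsplits-const xs (c ℕ.+ c)) (doubling (2 ℕ.^ length xs) c))
    where
    doubling : ∀ p c → p ℕ.* (c ℕ.+ c) ≡ 2 ℕ.* p ℕ.* c
    doubling = solve 2 (λ p c → p :* (c :+ c) := con 2 :* p :* c) refl
      where open +-*-Solver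

  length-properSplits : ∀ x xs → length (properSplits (x ∷ xs)) ℕ.+ 2 ≡ 2 ℕ.^ length (x ∷ xs)
  length-properSplits x xs = begin
    length P ℕ.+ 2                          ≡⟨ cong (ℕ._+ 2) (sym (ℕ.*-identityʳ (length P))) ⟩
    length P ℕ.* 1 ℕ.+ 2                    ≡⟨ ℕ.+-assoc (length P ℕ.* 1) 1 1 ⟨
    length P ℕ.* 1 ℕ.+ 1 ℕ.+ 1              ≡⟨ cong (λ s → s ℕ.+ 1 ℕ.+ 1) (sum-map-const 1 P) ⟨
    sum (map (λ _ → 1) P) ℕ.+ 1 ℕ.+ 1       ≡⟨ Σsplits-properSplits x xs (λ _ → 1) ⟨
    Σsplits (x ∷ xs) (λ _ → 1)              ≡⟨ Σsplits-const (x ∷ xs) 1 ⟩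
    2 ℕ.^ length (x ∷ xs) ℕ.* 1             ≡⟨ ℕ.*-identityʳ _ ⟩
    2 ℕ.^ length (x ∷ xs)                   ∎
    where
    open ≡-Reasoning
    P : List (Split n)
    P = properSplits (x ∷ xs)

  properSplits-nonZero : ∀ x y zs → ℕ.NonZero (length (properSplits (x ∷ y ∷ zs)))
  properSplits-nonZero x y zs = ℕ.>-nonZero (ℕ.<-≤-trans ℕ.z<s (ℕ.+-cancelʳ-≤ 2 2 _ 4≤|P|+2))
    where
    4≤|P|+2 : 4 ℕ.≤ length (properSplits (x ∷ y ∷ zs)) ℕ.+ 2
    4≤|P|+2 = ℕ.≤-trans (ℕ.^-monoʳ-≤ 2 {2} {2 ℕ.+ length zs} (ℕ.s≤s (ℕ.s≤s ℕ.z≤n)))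
                        (ℕ.≤-reflexive (sym (length-properSplits x (y ∷ zs))))

  splitProbability : List (Fin n) → ℚ
  splitProbability A = uniformWeight (length (properSplits A))

  splitProbability-inverse : ∀ (x y : Fin n) zs → let P = properSplits (x ∷ y ∷ zs) in
    splitProbability (x ∷ y ∷ zs) * ℕtoℚ (length P) ≡ 1ℚ
  splitProbability-inverse x y zs = uniformWeight-inverse _ {{properSplits-nonZero x y zs}}

-- The cut weight

module _ {n : ℕ} (i j : Fin n) where

  -- Three times the lower bound on E|T_ij| that induction yields once the first cut is (L , R):
  -- (2k + 2)/3 for a part of size k containing i and j, or |L| + |R| if the cut separates them.
  cutWeight : Split n → ℕ
  cutWeight (L , R) =
    if memb i L ∧ memb j L then 2 ℕ.* length L ℕ.+ 2
    else if memb i R ∧ memb j R then 2 ℕ.* length R ℕ.+ 2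
    else 3 ℕ.* (length L ℕ.+ length R)

  cutWeight-resp : RespectsPermutation cutWeight
  cutWeight-resp L↭L′ R↭R′
    rewrite memb-↭ i L↭L′ | memb-↭ j L↭L′ | memb-↭ i R↭R′ | memb-↭ j R↭R′ | ↭-length L↭L′ | ↭-length R↭R′ = refl

  cutWeight-left : ∀ {L R} → memb i L ∧ memb j L ≡ true → cutWeight (L , R) ≡ 2 ℕ.* length L ℕ.+ 2
  cutWeight-left ij∈L rewrite ij∈L = refl

  cutWeight-right : ∀ {L R} → memb i L ∧ memb j L ≡ false → memb i R ∧ memb j R ≡ true →
    cutWeight (L , R) ≡ 2 ℕ.* length R ℕ.+ 2
  cutWeight-right ij∉L ij∈R rewrite ij∉L | ij∈R = refl

  cutWeight-apart : ∀ {L R} → memb i L ∧ memb j L ≡ false → memb i R ∧ memb j R ≡ false →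
    cutWeight (L , R) ≡ 3 ℕ.* (length L ℕ.+ length R)
  cutWeight-apart ij∉L ij∉R rewrite ij∉L | ij∉R = refl

module _ {n : ℕ} {i j : Fin n} (i≢j : i ≢ j) where

  -- Whatever the other points do, the four placements of i and j give
  -- (2|L| + 6) + 3m + 3m + (2|R| + 6) = 4 (2m + 2), where m = |L| + |R| + 2.
  cutWeight-placements : ∀ {L R} → i ∉ L → j ∉ L → i ∉ R → j ∉ R →
    sumPlacements j (sumPlacements i (cutWeight i j)) (L , R) ≡
    sumPlacements j (sumPlacements i (λ _ → 2 ℕ.* (2 ℕ.+ (length L ℕ.+ length R)) ℕ.+ 2)) (L , R)
  cutWeight-placements {L} {R} i∉L j∉L i∉R j∉R =
    trans (cong₂ ℕ._+_ (cong₂ ℕ._+_ bothLeft iRight) (cong₂ ℕ._+_ iLeft bothRight))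
          (solve 2 (λ l r → (con 2 :* (con 2 :+ l) :+ con 2 :+ con 3 :* (con 1 :+ l :+ (con 1 :+ r)))
                              :+ (con 3 :* (con 1 :+ l :+ (con 1 :+ r)) :+ (con 2 :* (con 2 :+ r) :+ con 2))
                         := (c l r :+ c l r) :+ (c l r :+ c l r))
                 refl (length L) (length R))
    where
    open +-*-Solver
    c : ∀ {k} → Polynomial k → Polynomial k → Polynomial k
    c l r = con 2 :* (con 2 :+ (l :+ r)) :+ con 2
    l r : ℕ
    l = length L
    r = length R
    i∈ : ∀ X → memb i (i ∷ X) ≡ true
    i∈ X = ∈⇒memb {xs = i ∷ X} (here refl)
    j∈ : ∀ X → memb j (j ∷ X) ≡ true
    j∈ X = ∈⇒memb {xs = j ∷ X} (here refl)
    j∈i∷j∷ : ∀ X → memb j (i ∷ j ∷ X) ≡ true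
    j∈i∷j∷ X = ∈⇒memb {xs = i ∷ j ∷ X} (there (here refl))
    i∉j∷ : ∀ {X} → i ∉ X → memb i (j ∷ X) ≡ false
    i∉j∷ {X} i∉X = ∉⇒memb {xs = j ∷ X} (∉-∷ i≢j i∉X)
    j∉i∷ : ∀ {X} → j ∉ X → memb j (i ∷ X) ≡ false
    j∉i∷ {X} j∉X = ∉⇒memb {xs = i ∷ X} (∉-∷ (i≢j ∘ sym) j∉X)
    bothLeft : cutWeight i j (i ∷ j ∷ L , R) ≡ 2 ℕ.* (2 ℕ.+ l) ℕ.+ 2
    bothLeft = cutWeight-left i j {i ∷ j ∷ L} {R} (cong₂ _∧_ (i∈ (j ∷ L)) (j∈i∷j∷ L))
    iRight : cutWeight i j (j ∷ L , i ∷ R) ≡ 3 ℕ.* (1 ℕ.+ l ℕ.+ (1 ℕ.+ r))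
    iRight = cutWeight-apart i j {j ∷ L} {i ∷ R} (cong₂ _∧_ (i∉j∷ i∉L) (j∈ L)) (cong₂ _∧_ (i∈ R) (j∉i∷ j∉R))
    iLeft : cutWeight i j (i ∷ L , j ∷ R) ≡ 3 ℕ.* (1 ℕ.+ l ℕ.+ (1 ℕ.+ r))
    iLeft = cutWeight-apart i j {i ∷ L} {j ∷ R} (cong₂ _∧_ (i∈ L) (j∉i∷ j∉L)) (cong₂ _∧_ (i∉j∷ i∉R) (j∈ R))
    bothRight : cutWeight i j (L , i ∷ j ∷ R) ≡ 2 ℕ.* (2 ℕ.+ r) ℕ.+ 2
    bothRight = cutWeight-right i j {L} {i ∷ j ∷ R} (cong₂ _∧_ (∉⇒memb {xs = L} i∉L) (∉⇒memb {xs = L} j∉L))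
                                                    (cong₂ _∧_ (i∈ (j ∷ R)) (j∈i∷j∷ R))

  Σsplits-cutWeight : ∀ {A rest} → A ↭ i ∷ j ∷ rest → i ∉ rest → j ∉ rest →
    Σsplits A (cutWeight i j) ≡ Σsplits A (λ _ → 2 ℕ.* length A ℕ.+ 2)
  Σsplits-cutWeight {A} {rest} A↭ijrest i∉rest j∉rest = begin
    Σsplits A cw
      ≡⟨ Σsplits-↭ A↭ijrest (cutWeight-resp i j) ⟩
    Σsplits (i ∷ j ∷ rest) cw
      ≡⟨ Σsplits-∷∷ i j rest cw ⟩
    Σsplits rest (sumPlacements j (sumPlacements i cw))
      ≡⟨ cong sum (List.map-cong-local (All.map (λ {S} → placements S) (splits-IsSplitOf rest))) ⟩
    Σsplits rest (sumPlacements j (sumPlacements i κ))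
      ≡⟨ Σsplits-∷∷ i j rest κ ⟨
    Σsplits (i ∷ j ∷ rest) κ
      ≡⟨ Σsplits-↭ (↭-sym A↭ijrest) (λ _ _ → refl) ⟩
    Σsplits A κ ∎
    where
    open ≡-Reasoning
    cw κ : Split n → ℕ
    cw = cutWeight i j
    κ _ = 2 ℕ.* length A ℕ.+ 2
    placements : ∀ S → IsSplitOf rest S →
      sumPlacements j (sumPlacements i cw) S ≡ sumPlacements j (sumPlacements i κ) S
    placements (L , R) LR↭rest =
      trans (cutWeight-placements (∉L i∉rest) (∉L j∉rest) (∉R i∉rest) (∉R j∉rest))
            (cong (λ m → let c = 2 ℕ.* m ℕ.+ 2 in (c ℕ.+ c) ℕ.+ (c ℕ.+ c)) (sym |A|))
      where
      |A| : length A ≡ 2 ℕ.+ (length L ℕ.+ length R)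
      |A| = trans (↭-length A↭ijrest) (cong (2 ℕ.+_) (trans (sym (↭-length LR↭rest)) (List.length-++ L)))
      ∉L : ∀ {k} → k ∉ rest → k ∉ L
      ∉L k∉rest k∈L = k∉rest (∈-resp-↭ LR↭rest (∈-++⁺ˡ k∈L))
      ∉R : ∀ {k} → k ∉ rest → k ∉ R
      ∉R k∉rest k∈R = k∉rest (∈-resp-↭ LR↭rest (∈-++⁺ʳ L k∈R))

  ΣproperSplits-cutWeight : ∀ {x xs rest} → x ∷ xs ↭ i ∷ j ∷ rest → i ∉ rest → j ∉ rest →
    sum (map (cutWeight i j) (properSplits (x ∷ xs))) ≡
    length (properSplits (x ∷ xs)) ℕ.* (2 ℕ.* length (x ∷ xs) ℕ.+ 2)
  ΣproperSplits-cutWeight {x} {xs} A↭ijrest i∉rest j∉rest =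
    trans (ℕ.+-cancelʳ-≡ _ _ _ (ℕ.+-cancelʳ-≡ _ _ _ (begin
      sum (map cw P) ℕ.+ c ℕ.+ c
        ≡⟨ cong₂ (λ a b → sum (map cw P) ℕ.+ a ℕ.+ b) (sym bothLeft) (sym bothRight) ⟩
      sum (map cw P) ℕ.+ cw (A , []) ℕ.+ cw ([] , A)
        ≡⟨ Σsplits-properSplits x xs cw ⟨
      Σsplits A cw
        ≡⟨ Σsplits-cutWeight A↭ijrest i∉rest j∉rest ⟩
      Σsplits A (λ _ → c)
        ≡⟨ Σsplits-properSplits x xs (λ _ → c) ⟩
      sum (map (λ _ → c) P) ℕ.+ c ℕ.+ c ∎)))
    (sum-map-const c P)
    where
    open ≡-Reasoning
    A : List (Fin n)
    A = x ∷ xs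
    P : List (Split n)
    P = properSplits A
    cw : Split n → ℕ
    cw = cutWeight i j
    c : ℕ
    c = 2 ℕ.* length A ℕ.+ 2
    ij∈A : memb i A ∧ memb j A ≡ true
    ij∈A = cong₂ _∧_ (∈⇒memb (∈-resp-↭ (↭-sym A↭ijrest) (here refl)))
                     (∈⇒memb (∈-resp-↭ (↭-sym A↭ijrest) (there (here refl))))
    bothLeft : cw (A , []) ≡ c
    bothLeft = cutWeight-left i j {A} {[]} ij∈A
    bothRight : cw ([] , A) ≡ c
    bothRight = cutWeight-right i j {[]} {A} refl ij∈A

  average-cutWeight : ∀ {x y zs rest} → x ∷ y ∷ zs ↭ i ∷ j ∷ rest → i ∉ rest → j ∉ rest →
    let A = x ∷ y ∷ zs in
    sumℚ (map (λ S → splitProbability A * ℕtoℚ (cutWeight i j S)) (properSplits A)) ≡ ℕtoℚ (2 ℕ.* length A ℕ.+ 2)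
  average-cutWeight {x} {y} {zs} A↭ijrest i∉rest j∉rest = begin
    sumℚ (map (λ S → p * ℕtoℚ (cw S)) P)
      ≡⟨ sumℚ-*ˡ p (λ S → ℕtoℚ (cw S)) P ⟨
    p * sumℚ (map (λ S → ℕtoℚ (cw S)) P)
      ≡⟨ cong (p *_) (ℕtoℚ-sum cw P) ⟨
    p * ℕtoℚ (sum (map cw P))
      ≡⟨ cong (λ k → p * ℕtoℚ k) (ΣproperSplits-cutWeight A↭ijrest i∉rest j∉rest) ⟩
    p * ℕtoℚ (length P ℕ.* c)
      ≡⟨ cong (p *_) (ℕtoℚ-* (length P) c) ⟩
    p * (ℕtoℚ (length P) * ℕtoℚ c)
      ≡⟨ ℚ.*-assoc p (ℕtoℚ (length P)) (ℕtoℚ c) ⟨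
    p * ℕtoℚ (length P) * ℕtoℚ c
      ≡⟨ cong (_* ℕtoℚ c) (splitProbability-inverse x y zs) ⟩
    1ℚ * ℕtoℚ c
      ≡⟨ ℚ.*-identityˡ (ℕtoℚ c) ⟩
    ℕtoℚ c ∎
    where
    open ≡-Reasoning
    A : List (Fin n)
    A = x ∷ y ∷ zs
    P : List (Split n)
    P = properSplits A
    p : ℚ
    p = splitProbability A
    cw : Split n → ℕ
    cw = cutWeight i j
    c : ℕ
    c = 2 ℕ.* length A ℕ.+ 2

-- Recursive-Random-Cutting

module _ {n : ℕ} where

  expectNode : ℕ → Split n → (Tree n → ℚ) → ℚ
  expectNode f (L , R) g = expect (rrc f L) (λ tl → expect (rrc f R) (λ tr → g (node tl tr)))

  -- rrc (suc f) A is the concatenation of these over the proper cuts of A, with p = splitProbability A.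
  cutOutcomes : ℕ → ℚ → Split n → Dist (Tree n)
  cutOutcomes f p (L , R) =
    concatMap (λ (pl , tl) → map (λ (pr , tr) → (p * pl * pr , node tl tr)) (rrc f R)) (rrc f L)

  expect-cutOutcomes : ∀ f p S g → expect (cutOutcomes f p S) g ≡ p * expectNode f S g
  expect-cutOutcomes f p (L , R) g = begin
    expect (cutOutcomes f p (L , R)) g
      ≡⟨ expect-concatMap _ (rrc f L) g ⟩
    sumℚ (map (λ (pl , tl) → expect (map (λ (pr , tr) → (p * pl * pr , node tl tr)) (rrc f R)) g) (rrc f L))
      ≡⟨ cong sumℚ (List.map-cong (λ (pl , tl) → expect-map-scale (p * pl) (node tl) (rrc f R) g) (rrc f L)) ⟩
    sumℚ (map (λ (pl , tl) → p * pl * expect (rrc f R) (λ tr → g (node tl tr))) (rrc f L))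
      ≡⟨ cong sumℚ (List.map-cong (λ (pl , tl) → ℚ.*-assoc p pl _) (rrc f L)) ⟩
    sumℚ (map (λ (pl , tl) → p * (pl * expect (rrc f R) (λ tr → g (node tl tr)))) (rrc f L))
      ≡⟨ sumℚ-*ˡ p _ (rrc f L) ⟨
    p * expectNode f (L , R) g ∎
    where open ≡-Reasoning

  expect-rrc-∷∷ : ∀ f (x y : Fin n) zs g → let A = x ∷ y ∷ zs in
    expect (rrc (ℕ.suc f) A) g ≡ sumℚ (map (λ S → splitProbability A * expectNode f S g) (properSplits A))
  expect-rrc-∷∷ f x y zs g =
    trans (expect-concatMap (cutOutcomes f p) (properSplits A) g)
          (cong sumℚ (List.map-cong (λ S → expect-cutOutcomes f p S g) (properSplits A)))
    where
    A : List (Fin n)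
    A = x ∷ y ∷ zs
    p : ℚ
    p = splitProbability A

  IsOutcomeOn : List (Fin n) → ℚ × Tree n → Set
  IsOutcomeOn A (p , T) = 0ℚ ≤ p × leaves T ↭ A

  rrc-outcomes : ∀ f A → All (IsOutcomeOn A) (rrc f A)
  rrc-outcomes f [] = []
  rrc-outcomes f (x ∷ []) = (ℚ.nonNegative⁻¹ 1ℚ , ↭.refl) ∷ []
  rrc-outcomes ℕ.zero (x ∷ y ∷ zs) = []
  rrc-outcomes (ℕ.suc f) (x ∷ y ∷ zs) =
    All-concatMap⁺ (cutOutcomes f p) (properSplits A) (All.map (λ {S} → perSplit S) (properSplits-IsProperSplitOf A))
    where
    A : List (Fin n)
    A = x ∷ y ∷ zs
    p : ℚ
    p = splitProbability A
    perSplit : ∀ S → IsProperSplitOf A S → All (IsOutcomeOn A) (cutOutcomes f p S)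
    perSplit (L , R) (properSplit LR↭A _ _) =
      All-concatMap⁺ (λ (pl , tl) → map (λ (pr , tr) → (p * pl * pr , node tl tr)) (rrc f R)) (rrc f L)
        (All.map (λ {u} onL → All.map⁺ (All.map (λ {v} onR → join {u} {v} onL onR) (rrc-outcomes f R)))
                 (rrc-outcomes f L))
      where
      join : ∀ {(pl , tl) (pr , tr) : ℚ × Tree n} → IsOutcomeOn L (pl , tl) → IsOutcomeOn R (pr , tr) →
        IsOutcomeOn A (p * pl * pr , node tl tr)
      join (0≤pl , tl↭L) (0≤pr , tr↭R) =
        nonNeg*nonNeg (nonNeg*nonNeg (uniformWeight-nonNeg (length (properSplits A))) 0≤pl) 0≤pr ,
        ↭-trans (++⁺-↭ tl↭L tr↭R) LR↭A

  expectNode-left : ∀ f {L R g g₁} → mass (rrc f R) ≡ 1ℚ →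
    (∀ {tl tr} → leaves tl ↭ L → leaves tr ↭ R → g (node tl tr) ≡ g₁ tl) →
    expectNode f (L , R) g ≡ expect (rrc f L) g₁
  expectNode-left f {L} {R} {g} {g₁} massR≡1 g≡g₁ =
    expect-cong (All.map (λ {(_ , tl)} (_ , tl↭L) →
                            trans (expect-cong (All.map (λ (_ , tr↭R) → g≡g₁ tl↭L tr↭R) (rrc-outcomes f R)))
                                  (expect-const (rrc f R) (g₁ tl) massR≡1))
                         (rrc-outcomes f L))

  expectNode-right : ∀ f {L R g g₂} → mass (rrc f L) ≡ 1ℚ →
    (∀ {tl tr} → leaves tl ↭ L → leaves tr ↭ R → g (node tl tr) ≡ g₂ tr) →
    expectNode f (L , R) g ≡ expect (rrc f R) g₂
  expectNode-right f {L} {R} {g} {g₂} massL≡1 g≡g₂ =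
    trans (expect-cong (All.map (λ (_ , tl↭L) →
                                   expect-cong (All.map (λ (_ , tr↭R) → g≡g₂ tl↭L tr↭R) (rrc-outcomes f R)))
                                (rrc-outcomes f L)))
          (expect-const (rrc f L) (expect (rrc f R) g₂) massL≡1)

  properSplit-fuel : ∀ {f} {A L R : List (Fin n)} → IsProperSplitOf A (L , R) → length A ℕ.≤ 2 ℕ.+ f →
    length L ℕ.≤ 1 ℕ.+ f × length R ℕ.≤ 1 ℕ.+ f
  properSplit-fuel LR |A|≤2+f with |L|<|A| , |R|<|A| ← IsProperSplitOf⇒shorter LR =
    ℕ.s≤s⁻¹ (ℕ.<-≤-trans |L|<|A| |A|≤2+f) , ℕ.s≤s⁻¹ (ℕ.<-≤-trans |R|<|A| |A|≤2+f)

  mass-rrc : ∀ f (A : List (Fin n)) → 0 ℕ.< length A → length A ℕ.≤ 1 ℕ.+ f → mass (rrc f A) ≡ 1ℚ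
  mass-rrc f (x ∷ []) _ _ = refl
  mass-rrc ℕ.zero (x ∷ y ∷ zs) _ (ℕ.s≤s ())
  mass-rrc (ℕ.suc f) (x ∷ y ∷ zs) _ |A|≤2+f = begin
    mass (rrc (ℕ.suc f) A)
      ≡⟨ expect-rrc-∷∷ f x y zs (λ _ → 1ℚ) ⟩
    sumℚ (map (λ S → p * expectNode f S (λ _ → 1ℚ)) P)
      ≡⟨ sumℚ-cong (All.map (λ {S} → perSplit S) (properSplits-IsProperSplitOf A)) ⟩
    sumℚ (map (λ _ → p) P)
      ≡⟨ sumℚ-const p P ⟩
    ℕtoℚ (length P) * p
      ≡⟨ ℚ.*-comm (ℕtoℚ (length P)) p ⟩
    p * ℕtoℚ (length P)
      ≡⟨ splitProbability-inverse x y zs ⟩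
    1ℚ ∎
    where
    open ≡-Reasoning
    A : List (Fin n)
    A = x ∷ y ∷ zs
    P : List (Split n)
    P = properSplits A
    p : ℚ
    p = splitProbability A
    perSplit : ∀ S → IsProperSplitOf A S → p * expectNode f S (λ _ → 1ℚ) ≡ p
    perSplit (L , R) LR@(properSplit _ 0<|L| 0<|R|) with |L|≤ , |R|≤ ← properSplit-fuel {f} LR |A|≤2+f =
      trans (cong (p *_) expectNode≡1) (ℚ.*-identityʳ p)
      where
      expectNode≡1 : expectNode f (L , R) (λ _ → 1ℚ) ≡ 1ℚ
      expectNode≡1 = trans (expectNode-left f {L} {R} {λ _ → 1ℚ} {λ _ → 1ℚ} (mass-rrc f R 0<|R| |R|≤) (λ _ _ → refl))
                           (mass-rrc f L 0<|L| |L|≤)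

-- The expected size of T_ij

module _ {n : ℕ} (i j : Fin n) where

  lca : Tree n → ℚ
  lca T = ℕtoℚ (lcaSize T i j)

  expectedLca : ℕ → List (Fin n) → ℚ
  expectedLca f A = expect (rrc f A) lca

  lcaSize-left : ∀ {L tl tr} → leaves tl ↭ L → memb i L ∧ memb j L ≡ true → lcaSize (node tl tr) i j ≡ lcaSize tl i j
  lcaSize-left tl↭L ij∈L rewrite memb-↭ i tl↭L | memb-↭ j tl↭L | ij∈L = refl

  lcaSize-right : ∀ {L R tl tr} → leaves tl ↭ L → leaves tr ↭ R →
    memb i L ∧ memb j L ≡ false → memb i R ∧ memb j R ≡ true → lcaSize (node tl tr) i j ≡ lcaSize tr i j
  lcaSize-right tl↭L tr↭R ij∉L ij∈R
    rewrite memb-↭ i tl↭L | memb-↭ j tl↭L | memb-↭ i tr↭R | memb-↭ j tr↭R | ij∉L | ij∈R = refl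

  lcaSize-apart : ∀ {L R tl tr} → leaves tl ↭ L → leaves tr ↭ R →
    memb i L ∧ memb j L ≡ false → memb i R ∧ memb j R ≡ false → lcaSize (node tl tr) i j ≡ length L ℕ.+ length R
  lcaSize-apart {tl = tl} tl↭L tr↭R ij∉L ij∉R
    rewrite memb-↭ i tl↭L | memb-↭ j tl↭L | memb-↭ i tr↭R | memb-↭ j tr↭R | ij∉L | ij∉R =
    trans (List.length-++ (leaves tl)) (cong₂ ℕ._+_ (↭-length tl↭L) (↭-length tr↭R))

  expectNode-lca-left : ∀ f {L R} → mass (rrc f R) ≡ 1ℚ → memb i L ∧ memb j L ≡ true →
    expectNode f (L , R) lca ≡ expectedLca f L
  expectNode-lca-left f {L} {R} massR≡1 ij∈L =
    expectNode-left f {L} {R} {lca} {lca} massR≡1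
      (λ {tl} {tr} tl↭L _ → cong ℕtoℚ (lcaSize-left {tl = tl} {tr} tl↭L ij∈L))

  expectNode-lca-right : ∀ f {L R} → mass (rrc f L) ≡ 1ℚ →
    memb i L ∧ memb j L ≡ false → memb i R ∧ memb j R ≡ true → expectNode f (L , R) lca ≡ expectedLca f R
  expectNode-lca-right f {L} {R} massL≡1 ij∉L ij∈R =
    expectNode-right f {L} {R} {lca} {lca} massL≡1
      (λ {tl} {tr} tl↭L tr↭R → cong ℕtoℚ (lcaSize-right {tl = tl} {tr} tl↭L tr↭R ij∉L ij∈R))

  expectNode-lca-apart : ∀ f {L R} → mass (rrc f L) ≡ 1ℚ → mass (rrc f R) ≡ 1ℚ →
    memb i L ∧ memb j L ≡ false → memb i R ∧ memb j R ≡ false →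
    expectNode f (L , R) lca ≡ ℕtoℚ (length L ℕ.+ length R)
  expectNode-lca-apart f {L} {R} massL≡1 massR≡1 ij∉L ij∉R =
    trans (expectNode-left f {L} {R} {lca} {λ _ → ℕtoℚ (length L ℕ.+ length R)} massR≡1
             (λ {tl} {tr} tl↭L tr↭R → cong ℕtoℚ (lcaSize-apart {tl = tl} {tr} tl↭L tr↭R ij∉L ij∉R)))
          (expect-const (rrc f L) (ℕtoℚ (length L ℕ.+ length R)) massL≡1)

  LowerBound : ℕ → List (Fin n) → Set
  LowerBound f X = Unique X → i ∈ X → j ∈ X → ℕtoℚ (2 ℕ.* length X ℕ.+ 2) ≤ ℕtoℚ 3 * expectedLca f X

  cutWeight≤expectNode : ∀ f {A L R : List (Fin n)} → IsProperSplitOf A (L , R) → Unique A →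
    mass (rrc f L) ≡ 1ℚ → mass (rrc f R) ≡ 1ℚ → LowerBound f L → LowerBound f R →
    ℕtoℚ (cutWeight i j (L , R)) ≤ ℕtoℚ 3 * expectNode f (L , R) lca
  cutWeight≤expectNode f {A} {L} {R} (properSplit LR↭A _ _) uA massL≡1 massR≡1 boundL boundR =
    byLeft (memb i L ∧ memb j L) refl
    where
    open ℚ.≤-Reasoning
    uLR : Unique (L ++ R)
    uLR = Unique-resp-↭ (↭-sym LR↭A) uA
    goal : Set
    goal = ℕtoℚ (cutWeight i j (L , R)) ≤ ℕtoℚ 3 * expectNode f (L , R) lca
    byRight : memb i L ∧ memb j L ≡ false → ∀ b → memb i R ∧ memb j R ≡ b → goal
    byRight ij∉L false ij∉R = ℚ.≤-reflexive (begin-equality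
      ℕtoℚ (cutWeight i j (L , R))
        ≡⟨ cong ℕtoℚ (cutWeight-apart i j {L} {R} ij∉L ij∉R) ⟩
      ℕtoℚ (3 ℕ.* m)
        ≡⟨ ℕtoℚ-* 3 m ⟩
      ℕtoℚ 3 * ℕtoℚ m
        ≡⟨ cong (ℕtoℚ 3 *_) (expectNode-lca-apart f {L} {R} massL≡1 massR≡1 ij∉L ij∉R) ⟨
      ℕtoℚ 3 * expectNode f (L , R) lca ∎)
      where
      m : ℕ
      m = length L ℕ.+ length R
    byRight ij∉L true ij∈R = begin
      ℕtoℚ (cutWeight i j (L , R))
        ≡⟨ cong ℕtoℚ (cutWeight-right i j {L} {R} ij∉L ij∈R) ⟩
      ℕtoℚ (2 ℕ.* length R ℕ.+ 2)
        ≤⟨ boundR (Unique-++⁻ʳ L uLR) (memb⇒∈ (∧-conicalˡ _ _ ij∈R)) (memb⇒∈ (∧-conicalʳ _ _ ij∈R)) ⟩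
      ℕtoℚ 3 * expectedLca f R
        ≡⟨ cong (ℕtoℚ 3 *_) (expectNode-lca-right f {L} {R} massL≡1 ij∉L ij∈R) ⟨
      ℕtoℚ 3 * expectNode f (L , R) lca ∎
    byLeft : ∀ b → memb i L ∧ memb j L ≡ b → goal
    byLeft false ij∉L = byRight ij∉L (memb i R ∧ memb j R) refl
    byLeft true ij∈L = begin
      ℕtoℚ (cutWeight i j (L , R))
        ≡⟨ cong ℕtoℚ (cutWeight-left i j {L} {R} ij∈L) ⟩
      ℕtoℚ (2 ℕ.* length L ℕ.+ 2)
        ≤⟨ boundL (Unique-++⁻ˡ L uLR) (memb⇒∈ (∧-conicalˡ _ _ ij∈L)) (memb⇒∈ (∧-conicalʳ _ _ ij∈L)) ⟩
      ℕtoℚ 3 * expectedLca f L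
        ≡⟨ cong (ℕtoℚ 3 *_) (expectNode-lca-left f {L} {R} massR≡1 ij∈L) ⟨
      ℕtoℚ 3 * expectNode f (L , R) lca ∎

  expectedLca-lowerBound : i ≢ j → ∀ f (A : List (Fin n)) → length A ℕ.≤ 1 ℕ.+ f → LowerBound f A
  expectedLca-lowerBound i≢j f [] _ _ ()
  expectedLca-lowerBound i≢j f (x ∷ []) _ _ (here refl) (here refl) = contradiction refl i≢j
  expectedLca-lowerBound i≢j ℕ.zero (x ∷ y ∷ zs) (ℕ.s≤s ())
  expectedLca-lowerBound i≢j (ℕ.suc f) (x ∷ y ∷ zs) |A|≤2+f uA i∈A j∈A = via (∈×∈⇒↭∷∷ i≢j i∈A j∈A)
    where
    open ℚ.≤-Reasoning
    A : List (Fin n)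
    A = x ∷ y ∷ zs
    P : List (Split n)
    P = properSplits A
    p : ℚ
    p = splitProbability A
    perSplit : ∀ S → IsProperSplitOf A S → p * ℕtoℚ (cutWeight i j S) ≤ ℕtoℚ 3 * (p * expectNode f S lca)
    perSplit (L , R) LR@(properSplit _ 0<|L| 0<|R|) = begin
      p * ℕtoℚ (cutWeight i j (L , R))
        ≤⟨ ℚ.*-monoˡ-≤-nonNeg p {{nonNegative (uniformWeight-nonNeg (length P))}} bound ⟩
      p * (ℕtoℚ 3 * expectNode f (L , R) lca)
        ≡⟨ ℚ*.x∙yz≈y∙xz p (ℕtoℚ 3) _ ⟩
      ℕtoℚ 3 * (p * expectNode f (L , R) lca) ∎
      where
      |L|≤ : length L ℕ.≤ 1 ℕ.+ f
      |L|≤ = proj₁ (properSplit-fuel {f = f} LR |A|≤2+f)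
      |R|≤ : length R ℕ.≤ 1 ℕ.+ f
      |R|≤ = proj₂ (properSplit-fuel {f = f} LR |A|≤2+f)
      bound : ℕtoℚ (cutWeight i j (L , R)) ≤ ℕtoℚ 3 * expectNode f (L , R) lca
      bound = cutWeight≤expectNode f LR uA (mass-rrc f L 0<|L| |L|≤) (mass-rrc f R 0<|R| |R|≤)
                (expectedLca-lowerBound i≢j f L |L|≤) (expectedLca-lowerBound i≢j f R |R|≤)
    via : ∃[ rest ] A ↭ i ∷ j ∷ rest → ℕtoℚ (2 ℕ.* length A ℕ.+ 2) ≤ ℕtoℚ 3 * expectedLca (ℕ.suc f) A
    via (rest , A↭ijrest) = begin
      ℕtoℚ (2 ℕ.* length A ℕ.+ 2)
        ≡⟨ average-cutWeight i≢j A↭ijrest i∉rest j∉rest ⟨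
      sumℚ (map (λ S → p * ℕtoℚ (cutWeight i j S)) P)
        ≤⟨ sumℚ-mono-≤ (All.map (λ {S} → perSplit S) (properSplits-IsProperSplitOf A)) ⟩
      sumℚ (map (λ S → ℕtoℚ 3 * (p * expectNode f S lca)) P)
        ≡⟨ sumℚ-*ˡ (ℕtoℚ 3) (λ S → p * expectNode f S lca) P ⟨
      ℕtoℚ 3 * sumℚ (map (λ S → p * expectNode f S lca) P)
        ≡⟨ cong (ℕtoℚ 3 *_) (expect-rrc-∷∷ f x y zs lca) ⟨
      ℕtoℚ 3 * expectedLca (ℕ.suc f) A ∎
      where
      uijrest : Unique (i ∷ j ∷ rest)
      uijrest = Unique-resp-↭ A↭ijrest uA
      i∉rest : i ∉ rest
      i∉rest = Unique[x∷xs]⇒x∉xs uijrest ∘ there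
      j∉rest : j ∉ rest
      j∉rest with _ ∷ ujrest ← uijrest = Unique[x∷xs]⇒x∉xs ujrest

-- The objective

lcaSize-≤ : ∀ {n} (T : Tree n) i j → lcaSize T i j ℕ.≤ length (leaves T)
lcaSize-≤ (leaf x) i j = ℕ.≤-refl
lcaSize-≤ (node l r) i j with memb i (leaves l) ∧ memb j (leaves l)
... | true = ℕ.≤-trans (lcaSize-≤ l i j) (List.length-++-≤ˡ (leaves l))
... | false with memb i (leaves r) ∧ memb j (leaves r)
... | true = ℕ.≤-trans (lcaSize-≤ r i j) (List.length-++-≤ʳ (leaves r) {leaves l})
... | false = ℕ.≤-refl

pairs-distinct : ∀ n → All (λ (i , j) → i ≢ j) (pairs n)
pairs-distinct n = All-concatMap⁺ _ (allFin n) (All.universal row (allFin n))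
  where
  ordered : ∀ i j → All (λ (i , j) → i ≢ j) (if does (toℕ i ℕ.<? toℕ j) then [ (i , j) ] else [])
  ordered i j with toℕ i ℕ.<ᵇ toℕ j in i<ᵇj
  ... | true = (λ i≡j → ℕ.<-irrefl (cong toℕ i≡j) (ℕ.<ᵇ⇒< (toℕ i) (toℕ j) (subst T (sym i<ᵇj) _))) ∷ []
  ... | false = []
  row : ∀ i → All (λ (i , j) → i ≢ j)
                  (concatMap (λ j → if does (toℕ i ℕ.<? toℕ j) then [ (i , j) ] else []) (allFin n))
  row i = All-concatMap⁺ _ (allFin n) (All.universal (ordered i) (allFin n))

pair-lowerBound : ∀ n {i j : Fin n} → i ≢ j → (+ 2 / 3) * ℕtoℚ n ≤ expect (recursiveRandomCutting n) (lca i j)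
pair-lowerBound n {i} {j} i≢j = ℚ.*-cancelˡ-≤-pos (ℕtoℚ 3) (begin
  ℕtoℚ 3 * ((+ 2 / 3) * ℕtoℚ n)
    ≡⟨ ℚ.*-assoc (ℕtoℚ 3) (+ 2 / 3) (ℕtoℚ n) ⟨
  ℕtoℚ 2 * ℕtoℚ n
    ≡⟨ ℕtoℚ-* 2 n ⟨
  ℕtoℚ (2 ℕ.* n)
    ≤⟨ ℕtoℚ-mono-≤ (ℕ.m≤m+n (2 ℕ.* n) 2) ⟩
  ℕtoℚ (2 ℕ.* n ℕ.+ 2)
    ≡⟨ cong (λ m → ℕtoℚ (2 ℕ.* m ℕ.+ 2)) |V|≡n ⟨
  ℕtoℚ (2 ℕ.* length (allFin n) ℕ.+ 2)
    ≤⟨ expectedLca-lowerBound i j i≢j n (allFin n) (ℕ.≤-trans (ℕ.≤-reflexive |V|≡n) (ℕ.n≤1+n n))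
                                                  (allFin⁺ n) (∈-allFin i) (∈-allFin j) ⟩
  ℕtoℚ 3 * expect (recursiveRandomCutting n) (lca i j) ∎)
  where
  open ℚ.≤-Reasoning
  |V|≡n : length (allFin n) ≡ n
  |V|≡n = List.length-tabulate (λ k → k)

expect-objective : ∀ {n} (d : Dist (Tree n)) w →
  expect d (objective w) ≡ sumℚ (map (λ (i , j) → w i j * expect d (lca i j)) (pairs n))
expect-objective {n} d w =
  trans (expect-sumℚ d (λ (i , j) T → w i j * lca i j T) (pairs n))
        (cong sumℚ (List.map-cong (λ (i , j) → expect-*ˡ d (w i j) (lca i j)) (pairs n)))

theorem3 : (n : ℕ) (w : Fin n → Fin n → ℚ) → (∀ i j → 0ℚ ≤ w i j) →
    (T′ : Tree n) → IsHC T′ →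
    (+ 2 / 3) * objective w T′ ≤ expect (recursiveRandomCutting n) (objective w)
theorem3 n w w≥0 T′ T′-isHC = begin
  (+ 2 / 3) * objective w T′
    ≡⟨ sumℚ-*ˡ (+ 2 / 3) _ (pairs n) ⟩
  sumℚ (map (λ (i , j) → (+ 2 / 3) * (w i j * lca i j T′)) (pairs n))
    ≤⟨ sumℚ-mono-≤ (All.map (λ {(i , j)} → pairBound i j) (pairs-distinct n)) ⟩
  sumℚ (map (λ (i , j) → w i j * expect d (lca i j)) (pairs n))
    ≡⟨ expect-objective d w ⟨
  expect d (objective w) ∎
  where
  open ℚ.≤-Reasoning
  d : Dist (Tree n)
  d = recursiveRandomCutting n
  |T′|≡n : length (leaves T′) ≡ n
  |T′|≡n = trans (↭-length T′-isHC) (List.length-tabulate (λ k → k))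
  lcaBound : ∀ i j → i ≢ j → (+ 2 / 3) * lca i j T′ ≤ expect d (lca i j)
  lcaBound i j i≢j =
    ℚ.≤-trans (ℚ.*-monoˡ-≤-nonNeg (+ 2 / 3) (ℕtoℚ-mono-≤ (ℕ.≤-trans (lcaSize-≤ T′ i j) (ℕ.≤-reflexive |T′|≡n))))
              (pair-lowerBound n i≢j)
  pairBound : ∀ i j → i ≢ j → (+ 2 / 3) * (w i j * lca i j T′) ≤ w i j * expect d (lca i j)
  pairBound i j i≢j = begin
    (+ 2 / 3) * (w i j * lca i j T′)  ≡⟨ ℚ*.x∙yz≈y∙xz (+ 2 / 3) (w i j) (lca i j T′) ⟩
    w i j * ((+ 2 / 3) * lca i j T′)  ≤⟨ ℚ.*-monoˡ-≤-nonNeg (w i j) {{nonNegative (w≥0 i j)}} (lcaBound i j i≢j) ⟩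
    w i j * expect d (lca i j)        ∎
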